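{- For every integer $n\ge1$ and every $\lambda$, $\displaystyle\sum_{k=0}^{n-1}A(n,k;\lambda,-\lambda)=n!$.
   Context: A tile is a positive integer $m$ together with a marker that is absent ($m$), an up-arrow ($m\!\uparrow$) or a down-arrow ($m\!\downarrow$). For $n\ge1$ the set $\mathrm{GS}_n$ of generalized permutations of $[n]$ consists of words of tiles, each with an ascent set $\mathrm{asc}(\pi)$, defined recursively. $\mathrm{GS}_1$ contains only the word consisting of the unmarked tile $1$, with $\mathrm{asc}=\emptyset$. For $n\ge2$, $\mathrm{GS}_n$ consists of all words $\pi'$ obtained from some $\pi=\pi_1\cdots\pi_{n-1}\in\mathrm{GS}_{n-1}$ by one of: (i) insert the unmarked tile $n$ into gap $j$, $0\le j\le n-1$, i.e. $\pi'=\pi_1\cdots\pi_j\, n\,\pi_{j+1}\cdots\pi_{n-1}$; if $j=0$ then $\mathrm{asc}(\pi')=\{a+1: a\in\mathrm{asc}(\pi)\}$, and if $1\le j\le n-1$ then $\mathrm{asc}(\pi')=\{a\in\mathrm{asc}(\pi): a<j\}\cup\{j\}\cup\{a+1: a\in\mathrm{asc}(\pi),\ a>j\}$; (ii) insert $n\!\uparrow$ immediately left of $\pi_i$, $1\le i\le n-1$; then $\mathrm{asc}(\pi')=\{a\in\mathrm{asc}(\pi): a<i\}\cup\{i\}\cup\{a+1: a\in\mathrm{asc}(\pi), a\ge i\}$; (iii) insert $n\!\downarrow$ immediately left of $\pi_i$, $1\le i\le n-1$; then $\mathrm{asc}(\pi')=\{a\in\mathrm{asc}(\pi): a<i\}\cup\{a+1: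 a\in\mathrm{asc}(\pi), a\ge i\}$. For $\pi\in\mathrm{GS}_n$ let $\mathrm{nua}(\pi)$, $\mathrm{nda}(\pi)$ be the numbers of up-arrow and down-arrow tiles of $\pi$. Define $A(n,k;u,d)=\sum u^{\mathrm{nua}(\pi)}d^{\mathrm{nda}(\pi)}$ over all $\pi\in\mathrm{GS}_n$ with $|\mathrm{asc}(\pi)|=k$. -}

module Defs where

open import Data.Nat using (ℕ; zero; suc; _<ᵇ_; _≡ᵇ_)
open import Data.Bool using (Bool; true; false; if_then_else_)
open import Data.List using (List; []; _∷_; map; concatMap; length; filter; upTo; [_])
open import Data.Product using (_×_; _,_; proj₁; proj₂)
open import Algebra.Bundles using (CommutativeRing)
open import Level using (Level)

data Marker : Set where
  none up down : Marker

Tile : Set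
Tile = ℕ × Marker

-- A generalized permutation: a word of tiles together with its ascent set
-- (ascent set given as a list of distinct natural numbers)
GP : Set
GP = List Tile × List ℕ

-- insert x into gap j of a word (after the first j letters)
insertAt : {A : Set} → ℕ → A → List A → List A
insertAt zero    x ys       = x ∷ ys
insertAt (suc j) x []       = x ∷ []
insertAt (suc j) x (y ∷ ys) = y ∷ insertAt j x ys

-- ascent-set updates
-- (i), j = 0 : shift everything
ascGap0 : List ℕ → List ℕ
ascGap0 = map suc

-- (i), 1 ≤ j : {a < j} ∪ {j} ∪ {a+1 : a > j}
ascGap : ℕ → List ℕ → List ℕ
ascGap j as = j ∷ concatMap (λ a → if a <ᵇ j then [ a ] else (if a ≡ᵇ j then [] else [ suc a ])) as

-- (ii) : {a < i} ∪ {i} ∪ {a+1 : a ≥ i}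
ascUp : ℕ → List ℕ → List ℕ
ascUp i as = i ∷ map (λ a → if a <ᵇ i then a else suc a) as

-- (iii) : {a < i} ∪ {a+1 : a ≥ i}
ascDown : ℕ → List ℕ → List ℕ
ascDown i as = map (λ a → if a <ᵇ i then a else suc a) as

-- all children of π ∈ GS_{n-1} in GS_n (here m = n, the new letter; π has m-1 letters)
children : ℕ → GP → List GP
children m (w , as) =
    ((insertAt 0 (m , none) w , ascGap0 as)
      ∷ map (λ j → insertAt j (m , none) w , ascGap j as) (map suc (upTo (length w))))
  Data.List.++ (map (λ i → insertAt (Data.Nat.pred i) (m , up) w , ascUp i as) (map suc (upTo (length w)))
  Data.List.++  map (λ i → insertAt (Data.Nat.pred i) (m , down) w , ascDown i as) (map suc (upTo (length w))))

-- GS (suc n) lists GS_{n+1}; GS zero is unused (empty)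
GS : ℕ → List GP
GS zero = []
GS (suc zero) = (((1 , none) ∷ []) , []) ∷ []
GS (suc (suc n)) = concatMap (children (suc (suc n))) (GS (suc n))

isUp : Tile → Bool
isUp (_ , up) = true
isUp _        = false

isDown : Tile → Bool
isDown (_ , down) = true
isDown _          = false

countB : (Tile → Bool) → List Tile → ℕ
countB p []       = 0
countB p (t ∷ ts) = if p t then suc (countB p ts) else countB p ts

nua nda : GP → ℕ
nua (w , _) = countB isUp w
nda (w , _) = countB isDown w

module _ {c ℓ : Level} (R : CommutativeRing c ℓ) where
  open CommutativeRing R

  pow : Carrier → ℕ → Carrier
  pow x zero    = 1#
  pow x (suc e) = x * pow x e

  sumR : List Carrier → Carrier
  sumR []       = 0#
  sumR (x ∷ xs) = x + sumR xs

  fromℕ : ℕ → Carrier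
  fromℕ zero    = 0#
  fromℕ (suc n) = 1# + fromℕ n

  A : ℕ → ℕ → Carrier → Carrier → Carrier
  A n k u d = sumR (map (λ π → pow u (nua π) * pow d (nda π))
                        (filter (λ π → length (proj₂ π) Data.Nat.≟ k) (GS n)))

  sumTo : ℕ → (ℕ → Carrier) → Carrier
  sumTo m f = sumR (map f (upTo m))

module Submission where

open import Defs
open import Data.Nat using (ℕ; _≤_; _!)
open import Algebra.Bundles using (CommutativeRing)
open import Level using (Level)
open import Data.Nat using (zero; suc; _<_; _<ᵇ_; _≡ᵇ_; _≟_; s≤s; z≤n)
import Data.Nat as ℕ
open import Data.Nat.Properties using (≤-trans; m≤n⇒m≤1+n)
open import Data.Bool using (Bool; true; false; if_then_else_)
open import Data.List using (List; []; _∷_; _++_; map; concatMap; filter; length; upTo; applyUpTo)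
open import Data.List.Properties using (length-map; length-upTo; map-upTo)
open import Data.List.Relation.Unary.All as All using (All; []; _∷_)
open import Data.List.Relation.Unary.All.Properties using (++⁺; map⁺; concat⁺)
open import Data.Product using (_×_; _,_; proj₁; proj₂)
open import Relation.Binary.PropositionalEquality as ≡ using (_≡_; refl; cong)
import Algebra.Properties.CommutativeSemigroup as CommSemigroupProperties

-- Setting u = λ and d = -λ, the sum Σ_{k<n} A(n,k;λ,-λ) is
-- the total weight λ^{nua π}(-λ)^{nda π} of all of GS_n, because every π ∈ GS_n
-- has fewer than n ascents and so lies in exactly one ascent class k < n.  The
-- total weight is computed along the recursive construction: a word π with
-- m-1 letters has m unmarked children of weight w(π), m-1 up-arrow children of
-- weight λ w(π) and m-1 down-arrow children of weight -λ w(π); the arrow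
-- children cancel, so the children of π weigh m·w(π) in total and GS_n weighs n!.

countB-swap : ∀ (p : Tile → Bool) x y ws → countB p (x ∷ y ∷ ws) ≡ countB p (y ∷ x ∷ ws)
countB-swap p x y ws with p x | p y
... | true  | true  = refl
... | true  | false = refl
... | false | true  = refl
... | false | false = refl

countB-insertAt : ∀ (p : Tile → Bool) j t w → countB p (insertAt j t w) ≡ countB p (t ∷ w)
countB-insertAt p zero    t w        = refl
countB-insertAt p (suc j) t []       = refl
countB-insertAt p (suc j) t (y ∷ ys) =
  ≡.trans (cong (λ c → if p y then suc c else c) (countB-insertAt p j t ys))
          (countB-swap p y t ys)

length-insertAt : ∀ {A : Set} j (x : A) w → length (insertAt j x w) ≡ suc (length w)
length-insertAt zero    x w        = refl
length-insertAt (suc j) x []       = refl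
length-insertAt (suc j) x (y ∷ ys) = cong suc (length-insertAt j x ys)

-- Rule (i) with j ≥ 1 adds at most one ascent (it may merge j with an old one).
length-ascGap : ∀ j as → length (ascGap j as) ≤ suc (length as)
length-ascGap j []       = s≤s z≤n
length-ascGap j (a ∷ as) with a <ᵇ j | a ≡ᵇ j
... | true  | _     = s≤s (length-ascGap j as)
... | false | true  = m≤n⇒m≤1+n (length-ascGap j as)
... | false | false = s≤s (length-ascGap j as)

length-map-≤ : ∀ (f : ℕ → ℕ) as {k} → length as ≤ k → length (map f as) ≤ k
length-map-≤ f as = ≡.subst (_≤ _) (≡.sym (length-map f as))

HasShape : ℕ → GP → Set
HasShape n (w , as) = length w ≡ suc n × length as ≤ n

children-shape : ∀ {n} m w as → HasShape n (w , as) → All (HasShape (suc n)) (children m (w , as))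
children-shape {n} m w as (|w| , |as|) =
  ++⁺ ((grown 0 (m , none) , length-map-≤ suc as (m≤n⇒m≤1+n |as|)) ∷ map⁺ (All.universal gapChild ys))
      (++⁺ (map⁺ (All.universal upChild ys)) (map⁺ (All.universal downChild ys)))
  where
  ys : List ℕ
  ys = map suc (upTo (length w))
  shift : ℕ → ℕ → ℕ
  shift i a = if a <ᵇ i then a else suc a
  grown : ∀ j t → length (insertAt j t w) ≡ suc (suc n)
  grown j t = ≡.trans (length-insertAt j t w) (cong suc |w|)
  gapChild : ∀ j → HasShape (suc n) (insertAt j (m , none) w , ascGap j as)
  gapChild j = grown j (m , none) , ≤-trans (length-ascGap j as) (s≤s |as|)
  upChild : ∀ i → HasShape (suc n) (insertAt (ℕ.pred i) (m , up) w , ascUp i as)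
  upChild i = grown (ℕ.pred i) (m , up) , s≤s (length-map-≤ (shift i) as |as|)
  downChild : ∀ i → HasShape (suc n) (insertAt (ℕ.pred i) (m , down) w , ascDown i as)
  downChild i = grown (ℕ.pred i) (m , down) , length-map-≤ (shift i) as (m≤n⇒m≤1+n |as|)

GS-shape : ∀ n → All (HasShape n) (GS (suc n))
GS-shape zero    = (refl , z≤n) ∷ []
GS-shape (suc n) = concat⁺ (map⁺ (All.map (λ {π} → children-shape (suc (suc n)) (proj₁ π) (proj₂ π)) (GS-shape n)))

module RingSums {c ℓ : Level} (R : CommutativeRing c ℓ) where
  open CommutativeRing R hiding (refl)
  open import Relation.Binary.Reasoning.Setoid setoid
  open CommutativeRing R using () renaming (refl to ≈-refl)

  Σ : List Carrier → Carrier
  Σ = sumR R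

  F : ℕ → Carrier
  F = fromℕ R

  fromℕ-suc-* : ∀ m x → F (suc m) * x ≈ x + F m * x
  fromℕ-suc-* m x = begin
    (1# + F m) * x   ≈⟨ distribʳ x 1# (F m) ⟩
    1# * x + F m * x ≈⟨ +-congʳ (*-identityˡ x) ⟩
    x + F m * x      ∎

  fromℕ-+ : ∀ a b → F (a ℕ.+ b) ≈ F a + F b
  fromℕ-+ zero    b = sym (+-identityˡ (F b))
  fromℕ-+ (suc a) b = trans (+-congˡ (fromℕ-+ a b)) (sym (+-assoc 1# (F a) (F b)))

  fromℕ-* : ∀ a b → F (a ℕ.* b) ≈ F a * F b
  fromℕ-* zero    b = sym (zeroˡ (F b))
  fromℕ-* (suc a) b = begin
    F (b ℕ.+ a ℕ.* b)  ≈⟨ fromℕ-+ b (a ℕ.* b) ⟩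
    F b + F (a ℕ.* b)  ≈⟨ +-congˡ (fromℕ-* a b) ⟩
    F b + F a * F b    ≈⟨ sym (fromℕ-suc-* a (F b)) ⟩
    F (suc a) * F b    ∎

  sumR-++ : ∀ {X : Set} (h : X → Carrier) xs ys → Σ (map h (xs ++ ys)) ≈ Σ (map h xs) + Σ (map h ys)
  sumR-++ h []       ys = sym (+-identityˡ _)
  sumR-++ h (x ∷ xs) ys = trans (+-congˡ (sumR-++ h xs ys)) (sym (+-assoc _ _ _))

  sumR-concatMap : ∀ {X Y : Set} (h : Y → Carrier) (g : X → List Y) xs →
    Σ (map h (concatMap g xs)) ≈ Σ (map (λ x → Σ (map h (g x))) xs)
  sumR-concatMap h g []       = ≈-refl
  sumR-concatMap h g (x ∷ xs) = trans (sumR-++ h (g x) (concatMap g xs)) (+-congˡ (sumR-concatMap h g xs))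

  sumR-cong : ∀ {X : Set} {g h : X → Carrier} {xs} → All (λ x → g x ≈ h x) xs → Σ (map g xs) ≈ Σ (map h xs)
  sumR-cong []       = ≈-refl
  sumR-cong (e ∷ es) = +-cong e (sumR-cong es)

  sumR-+ : ∀ {X : Set} (g h : X → Carrier) xs → Σ (map (λ x → g x + h x) xs) ≈ Σ (map g xs) + Σ (map h xs)
  sumR-+ g h []       = sym (+-identityˡ 0#)
  sumR-+ g h (x ∷ xs) = begin
    (g x + h x) + Σ (map (λ x → g x + h x) xs)  ≈⟨ +-congˡ (sumR-+ g h xs) ⟩
    (g x + h x) + (Σ (map g xs) + Σ (map h xs)) ≈⟨ +-assoc (g x) (h x) _ ⟩
    g x + (h x + (Σ (map g xs) + Σ (map h xs))) ≈⟨ +-congˡ (x∙yz≈y∙xz (h x) _ _) ⟩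
    g x + (Σ (map g xs) + (h x + Σ (map h xs))) ≈⟨ sym (+-assoc (g x) _ _) ⟩
    (g x + Σ (map g xs)) + (h x + Σ (map h xs)) ∎
    where open CommSemigroupProperties +-commutativeSemigroup using (x∙yz≈y∙xz)

  sumR-*ˡ : ∀ {X : Set} a (h : X → Carrier) xs → Σ (map (λ x → a * h x) xs) ≈ a * Σ (map h xs)
  sumR-*ˡ a h []       = sym (zeroʳ a)
  sumR-*ˡ a h (x ∷ xs) = trans (+-congˡ (sumR-*ˡ a h xs)) (sym (distribˡ a (h x) _))

  δ : ℕ → ℕ → Carrier → Carrier
  δ a k v = if a ≡ᵇ k then v else 0#

  sumR-zeros : ∀ n → Σ (applyUpTo (λ _ → 0#) n) ≈ 0#
  sumR-zeros zero    = ≈-refl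
  sumR-zeros (suc n) = trans (+-identityˡ _) (sumR-zeros n)

  -- Σ_{k<n} δ(a,k)·v = v whenever a < n.  Shifting the index, δ (suc a) (suc k) reduces to δ a k and δ (suc a) 0 to 0.
  sumR-δ : ∀ {a n} v → a < n → Σ (applyUpTo (λ k → δ a k v) n) ≈ v
  sumR-δ {zero}  {suc n} v _         = trans (+-congˡ (sumR-zeros n)) (+-identityʳ v)
  sumR-δ {suc a} {suc n} v (s≤s a<n) = trans (+-identityˡ _) (sumR-δ v a<n)

  class-∷ : ∀ {X : Set} (s : X → ℕ) (h : X → Carrier) k x xs →
    Σ (map h (filter (λ y → s y ≟ k) (x ∷ xs))) ≈ δ (s x) k (h x) + Σ (map h (filter (λ y → s y ≟ k) xs))
  class-∷ s h k x xs with s x ≡ᵇ k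
  ... | true  = ≈-refl
  ... | false = sym (+-identityˡ _)

  sumR-classes : ∀ {X : Set} (s : X → ℕ) (h : X → Carrier) n xs → All (λ x → s x < n) xs →
    Σ (map (λ k → Σ (map h (filter (λ y → s y ≟ k) xs))) (upTo n)) ≈ Σ (map h xs)
  sumR-classes s h n [] [] = trans (reflexive (cong Σ (map-upTo (λ _ → 0#) n))) (sumR-zeros n)
  sumR-classes {X} s h n (x ∷ xs) (sx<n ∷ bounded) = begin
    Σ (map (λ k → class k (x ∷ xs)) (upTo n))
      ≈⟨ sumR-cong (All.universal (λ k → class-∷ s h k x xs) (upTo n)) ⟩
    Σ (map (λ k → δ (s x) k (h x) + class k xs) (upTo n))
      ≈⟨ sumR-+ (λ k → δ (s x) k (h x)) (λ k → class k xs) (upTo n) ⟩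
    Σ (map (λ k → δ (s x) k (h x)) (upTo n)) + Σ (map (λ k → class k xs) (upTo n))
      ≈⟨ +-cong (reflexive (cong Σ (map-upTo (λ k → δ (s x) k (h x)) n))) (sumR-classes s h n xs bounded) ⟩
    Σ (applyUpTo (λ k → δ (s x) k (h x)) n) + Σ (map h xs)
      ≈⟨ +-congʳ (sumR-δ (h x) sx<n) ⟩
    h x + Σ (map h xs) ∎
    where
    class : ℕ → List X → Carrier
    class k ys = Σ (map h (filter (λ y → s y ≟ k) ys))

  opposite-cancel : ∀ a x y → a * (x * y) + a * ((- x) * y) ≈ 0#
  opposite-cancel a x y = begin
    a * (x * y) + a * ((- x) * y) ≈⟨ sym (distribˡ a _ _) ⟩
    a * (x * y + (- x) * y)       ≈⟨ *-congˡ (sym (distribʳ y x (- x))) ⟩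
    a * ((x + - x) * y)           ≈⟨ *-congˡ (*-congʳ (-‿inverseʳ x)) ⟩
    a * (0# * y)                  ≈⟨ *-congˡ (zeroˡ y) ⟩
    a * 0#                        ≈⟨ zeroʳ a ⟩
    0#                            ∎

module Weights {c ℓ : Level} (R : CommutativeRing c ℓ) (λ' : CommutativeRing.Carrier R) where
  open CommutativeRing R hiding (refl)
  open RingSums R
  open import Relation.Binary.Reasoning.Setoid setoid

  weight : GP → Carrier
  weight π = pow R λ' (nua π) * pow R (- λ') (nda π)

  weight-insertAt : ∀ j t w as as' → weight (insertAt j t w , as') ≡ weight (t ∷ w , as)
  weight-insertAt j t w as as' =
    ≡.cong₂ (λ a b → pow R λ' a * pow R (- λ') b) (countB-insertAt isUp j t w) (countB-insertAt isDown j t w)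

  insertions-weight : ∀ t w as (pos : ℕ → ℕ) (asc : ℕ → List ℕ) is →
    Σ (map weight (map (λ i → insertAt (pos i) t w , asc i) is)) ≈ F (length is) * weight (t ∷ w , as)
  insertions-weight t w as pos asc []       = sym (zeroˡ _)
  insertions-weight t w as pos asc (i ∷ is) = begin
    weight (insertAt (pos i) t w , asc i) + Σ (map weight (map (λ i → insertAt (pos i) t w , asc i) is))
      ≈⟨ +-cong (reflexive (weight-insertAt (pos i) t w as (asc i))) (insertions-weight t w as pos asc is) ⟩
    weight (t ∷ w , as) + F (length is) * weight (t ∷ w , as)
      ≈⟨ sym (fromℕ-suc-* (length is) _) ⟩
    F (suc (length is)) * weight (t ∷ w , as) ∎

  weight-up : ∀ m w as → weight ((m , up) ∷ w , as) ≈ λ' * weight (w , as)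
  weight-up m w as = *-assoc λ' _ _

  weight-down : ∀ m w as → weight ((m , down) ∷ w , as) ≈ (- λ') * weight (w , as)
  weight-down m w as = x∙yz≈y∙xz _ (- λ') _
    where open CommSemigroupProperties *-commutativeSemigroup using (x∙yz≈y∙xz)

  -- The arrow children cancel, so the children of π weigh (|π| + 1)·weight π.
  children-weight : ∀ m w as → Σ (map weight (children m (w , as))) ≈ F (suc (length w)) * weight (w , as)
  children-weight m w as = begin
    Σ (map weight ((front ∷ map plain gaps) ++ (map upward gaps ++ map downward gaps)))
      ≈⟨ sumR-++ weight (front ∷ map plain gaps) _ ⟩
    (weight front + Σ (map weight (map plain gaps))) + Σ (map weight (map upward gaps ++ map downward gaps))
      ≈⟨ +-congˡ (sumR-++ weight (map upward gaps) (map downward gaps)) ⟩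
    (weight front + Σ (map weight (map plain gaps)))
      + (Σ (map weight (map upward gaps)) + Σ (map weight (map downward gaps)))
      ≈⟨ +-cong (+-congˡ (insertions-weight (m , none) w as (λ j → j) (λ j → ascGap j as) gaps))
                (+-cong (trans (insertions-weight (m , up) w as ℕ.pred (λ i → ascUp i as) gaps)
                               (*-congˡ (weight-up m w as)))
                        (trans (insertions-weight (m , down) w as ℕ.pred (λ i → ascDown i as) gaps)
                               (*-congˡ (weight-down m w as)))) ⟩
    (φ + F L * φ) + (F L * (λ' * φ) + F L * ((- λ') * φ))
      ≈⟨ +-cong (sym (fromℕ-suc-* L φ)) (opposite-cancel (F L) λ' φ) ⟩
    F (suc L) * φ + 0#
      ≈⟨ +-identityʳ _ ⟩
    F (suc L) * φ
      ≈⟨ reflexive (cong (λ l → F (suc l) * φ) |gaps|) ⟩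
    F (suc (length w)) * φ ∎
    where
    φ : Carrier
    φ = weight (w , as)
    gaps : List ℕ
    gaps = map suc (upTo (length w))
    L : ℕ
    L = length gaps
    |gaps| : L ≡ length w
    |gaps| = ≡.trans (length-map suc (upTo (length w))) (length-upTo (length w))
    front : GP
    front = insertAt 0 (m , none) w , ascGap0 as
    plain upward downward : ℕ → GP
    plain = λ j → insertAt j (m , none) w , ascGap j as
    upward = λ i → insertAt (ℕ.pred i) (m , up) w , ascUp i as
    downward = λ i → insertAt (ℕ.pred i) (m , down) w , ascDown i as

  children-weight-shape : ∀ {n} m π → HasShape n π → Σ (map weight (children m π)) ≈ F (suc (suc n)) * weight π
  children-weight-shape m (w , as) (|w| , _) =
    trans (children-weight m w as) (reflexive (cong (λ l → F (suc l) * weight (w , as)) |w|))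

  GS-weight : ∀ n → Σ (map weight (GS (suc n))) ≈ F (suc n !)
  GS-weight zero    = +-congʳ (*-identityˡ 1#)
  GS-weight (suc n) = begin
    Σ (map weight (concatMap (children (suc (suc n))) (GS (suc n))))
      ≈⟨ sumR-concatMap weight (children (suc (suc n))) (GS (suc n)) ⟩
    Σ (map (λ π → Σ (map weight (children (suc (suc n)) π))) (GS (suc n)))
      ≈⟨ sumR-cong (All.map (λ {π} → children-weight-shape (suc (suc n)) π) (GS-shape n)) ⟩
    Σ (map (λ π → F (suc (suc n)) * weight π) (GS (suc n)))
      ≈⟨ sumR-*ˡ (F (suc (suc n))) weight (GS (suc n)) ⟩
    F (suc (suc n)) * Σ (map weight (GS (suc n)))
      ≈⟨ *-congˡ (GS-weight n) ⟩
    F (suc (suc n)) * F (suc n !)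
      ≈⟨ sym (fromℕ-* (suc (suc n)) (suc n !)) ⟩
    F (suc (suc n) !) ∎

-- Σ_{k<n} A(n,k;λ,-λ) = n!: the ascent classes k < n exhaust GS_n, whose weight is n!.
mainTheorem8 : {c ℓ : Level} (R : CommutativeRing c ℓ) (n : ℕ) → 1 ≤ n → (λ' : CommutativeRing.Carrier R) →
    CommutativeRing._≈_ R (sumTo R n (λ k → A R n k λ' (CommutativeRing.-_ R λ'))) (fromℕ R (n !))
mainTheorem8 R (suc n) _ λ' = begin
  sumTo R (suc n) (λ k → A R (suc n) k λ' (- λ'))
    ≈⟨ sumR-classes (λ π → length (proj₂ π)) weight (suc n) (GS (suc n)) fewer-ascents ⟩
  Σ (map weight (GS (suc n)))
    ≈⟨ GS-weight n ⟩
  fromℕ R (suc n !) ∎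
  where
  open CommutativeRing R using (setoid; -_)
  open import Relation.Binary.Reasoning.Setoid setoid
  open RingSums R using (Σ; sumR-classes)
  open Weights R λ' using (weight; GS-weight)
  fewer-ascents : All (λ π → length (proj₂ π) < suc n) (GS (suc n))
  fewer-ascents = All.map (λ (_ , |as|) → s≤s |as|) (GS-shape n)
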